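{- For every positive integer $n$, $w_n(x)=s_n(x)$ as polynomials in $x$.
   Context: For integers $n\ge k\ge1$, $N(n,k)=\frac1n\binom{n}{k}\binom{n}{k-1}$ and $w(n,k)=\frac1k\binom{n-1}{k-1}\binom{n+k}{k-1}$. For $n\ge1$, $s_n(x)=\sum_{k=1}^nN(n,k)x^{k-1}(x+1)^{n-k}$ and $w_n(x)=\sum_{k=1}^nw(n,k)x^{k-1}$. -}

module Defs where

open import Data.Nat as ℕ using (ℕ; zero; suc; _∸_)
open import Data.Nat.Combinatorics using (_C_)
open import Data.Integer using (+_)
open import Data.Rational using (ℚ; 0ℚ; 1ℚ; _/_; _+_; _*_)
open import Data.List using (List; []; _∷_; map; upTo)

-- Univariate polynomials over ℚ as coefficient lists, lowest degree first.
Poly : Set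
Poly = List ℚ

coeff : Poly → ℕ → ℚ
coeff []       _       = 0ℚ
coeff (a ∷ p)  zero    = a
coeff (a ∷ p)  (suc j) = coeff p j

_⊕_ : Poly → Poly → Poly
[]      ⊕ q       = q
p       ⊕ []      = p
(a ∷ p) ⊕ (b ∷ q) = (a + b) ∷ (p ⊕ q)

scale : ℚ → Poly → Poly
scale c p = map (c *_) p

_⊗_ : Poly → Poly → Poly
[]      ⊗ q = []
(a ∷ p) ⊗ q = scale a q ⊕ (0ℚ ∷ (p ⊗ q))

const : ℚ → Poly
const c = c ∷ []

X : Poly
X = 0ℚ ∷ 1ℚ ∷ []

_^ₚ_ : Poly → ℕ → Poly
p ^ₚ zero  = const 1ℚ
p ^ₚ suc m = p ⊗ (p ^ₚ m)

sumFrom1 : ℕ → (ℕ → Poly) → Poly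
sumFrom1 zero    f = []
sumFrom1 (suc n) f = sumFrom1 n f ⊕ f (suc n)

N : (n k : ℕ) → .{{ℕ.NonZero n}} → ℚ
N n k = + ((n C k) ℕ.* (n C (k ∸ 1))) / n

w : (n k : ℕ) → .{{ℕ.NonZero k}} → ℚ
w n k = + (((n ∸ 1) C (k ∸ 1)) ℕ.* ((n ℕ.+ k) C (k ∸ 1))) / k

s : (n : ℕ) → .{{ℕ.NonZero n}} → Poly
s n = sumFrom1 n (λ k → scale (N n k) ((X ^ₚ (k ∸ 1)) ⊗ ((X ⊕ const 1ℚ) ^ₚ (n ∸ k))))

wp : (n : ℕ) → Poly
wp n = sumFrom1 n (λ k → wk k)
  where
  wk : ℕ → Poly
  wk zero    = []   -- never used: k ranges over 1..n
  wk (suc k) = scale (w n (suc k)) (X ^ₚ k)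

module Submission where

-- Lemma 4.5: w_n(x) = s_n(x), compared coefficient by coefficient, with n = m+1.
-- Every coefficient of either polynomial is a natural number over a positive denominator:
--   [x^j] w_n = w(n, j+1) = C(m,j)·C(n+j+1,j) / (j+1)                     (coeff-wp)
--   [x^j] s_n = Σ_k C(n,k)·C(n,k-1)·C(n-k, j+1-k) / n                      (coeff-s)
-- since [x^j] x^(k-1)(x+1)^(n-k) = C(n-k, j+1-k). Cross-multiplying, the theorem reduces to
--   (j+1)·Σ_k C(n,k)·C(n,k-1)·C(n-k, j+1-k) = n·C(m,j)·C(n+j+1,j)           (numerator-identity)
-- which follows from trinomial revision C(n,k)C(n-k,i-k) = C(n,i)C(i,k), Vandermonde's
-- convolution Σ_k C(i,k)C(n,k-1) = C(n+i, n+1), and absorption i·C(n,i) = n·C(n-1,i-1).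

open import Defs
open import Data.Nat using (ℕ; suc)
open import Relation.Binary.PropositionalEquality using (_≡_)

module BinomialIdentities where

  open import Data.Nat
  open import Data.Nat.Properties
  open import Data.Nat.Combinatorics
  open import Data.Nat.DivMod using (_/_; m*[n/m]≡n)
  open import Data.Nat.Divisibility using (_∣_)
  open import Data.Nat.Tactic.RingSolver using (solve-∀)
  open import Relation.Binary.PropositionalEquality
  open ≡-Reasoning

  data Split (a : ℕ) : ℕ → Set where
    above : ∀ r → Split a (a + r)
    below : ∀ {b} → b < a → Split a b

  split : ∀ a b → Split a b
  split zero    b       = above b
  split (suc a) zero    = below z<s
  split (suc a) (suc b) with split a b
  ... | above r   = above r
  ... | below b<a = below (s<s b<a)

  sumℕ : ℕ → (ℕ → ℕ) → ℕ
  sumℕ zero    f = 0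
  sumℕ (suc n) f = sumℕ n f + f n

  syntax sumℕ n (λ t → e) = Σℕ[ t < n ] e

  sum-cong : ∀ n {f g : ℕ → ℕ} → (∀ t → f t ≡ g t) → sumℕ n f ≡ sumℕ n g
  sum-cong zero    f≗g = refl
  sum-cong (suc n) f≗g = cong₂ _+_ (sum-cong n f≗g) (f≗g n)

  sum-zero : ∀ n (f : ℕ → ℕ) → (∀ t → f t ≡ 0) → sumℕ n f ≡ 0
  sum-zero zero    f f≗0 = refl
  sum-zero (suc n) f f≗0 = cong₂ _+_ (sum-zero n f f≗0) (f≗0 n)

  sum-+ : ∀ n (f g : ℕ → ℕ) → Σℕ[ t < n ] (f t + g t) ≡ sumℕ n f + sumℕ n g
  sum-+ zero    f g = refl
  sum-+ (suc n) f g = begin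
    Σℕ[ t < n ] (f t + g t) + (f n + g n) ≡⟨ cong (_+ (f n + g n)) (sum-+ n f g) ⟩
    sumℕ n f + sumℕ n g + (f n + g n)     ≡⟨ interchange (sumℕ n f) (sumℕ n g) (f n) (g n) ⟩
    sumℕ n f + f n + (sumℕ n g + g n)     ∎
    where
    interchange : ∀ a b c d → a + b + (c + d) ≡ a + c + (b + d)
    interchange = solve-∀

  sum-scale : ∀ n c (f : ℕ → ℕ) → Σℕ[ t < n ] (c * f t) ≡ c * sumℕ n f
  sum-scale zero    c f = sym (*-zeroʳ c)
  sum-scale (suc n) c f =
    trans (cong (_+ c * f n) (sum-scale n c f)) (sym (*-distribˡ-+ c (sumℕ n f) (f n)))

  sum-front : ∀ n (f : ℕ → ℕ) → sumℕ (suc n) f ≡ f 0 + Σℕ[ t < n ] f (suc t)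
  sum-front zero    f = +-comm 0 (f 0)
  sum-front (suc n) f = begin
    sumℕ (suc n) f + f (suc n)                      ≡⟨ cong (_+ f (suc n)) (sum-front n f) ⟩
    f 0 + Σℕ[ t < n ] f (suc t) + f (suc n)         ≡⟨ +-assoc (f 0) _ (f (suc n)) ⟩
    f 0 + (Σℕ[ t < n ] f (suc t) + f (suc n))       ∎

  -- The coefficient sequence of x^a · f(x): f shifted up by a, padded with zeros.
  shift : ℕ → (ℕ → ℕ) → ℕ → ℕ
  shift zero    f i       = f i
  shift (suc a) f zero    = 0
  shift (suc a) f (suc i) = shift a f i

  shift-above : ∀ a f r → shift a f (a + r) ≡ f r
  shift-above zero    f r = refl
  shift-above (suc a) f r = shift-above a f r

  shift-below : ∀ a f i → i < a → shift a f i ≡ 0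
  shift-below (suc a) f zero    _         = refl
  shift-below (suc a) f (suc i) (s<s i<a) = shift-below a f i i<a

  choose-factorial : ∀ k l → ((k + l) C k) * (k ! * l !) ≡ (k + l) !
  choose-factorial k l = begin
    ((k + l) C k) * (k ! * l !)            ≡⟨ cong (_* (k ! * l !)) C≡quotient ⟩
    ((k + l) ! / (k ! * l !)) * (k ! * l !) ≡⟨ *-comm _ (k ! * l !) ⟩
    (k ! * l !) * ((k + l) ! / (k ! * l !)) ≡⟨ m*[n/m]≡n k!l!∣[k+l]! ⟩
    (k + l) !                               ∎
    where
    instance
      k!l!≢0 : NonZero (k ! * l !)
      k!l!≢0 = k !* l !≢0
    k+l∸k≡l : k + l ∸ k ≡ l
    k+l∸k≡l = m+n∸m≡n k l
    C≡quotient : (k + l) C k ≡ (k + l) ! / (k ! * l !)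
    C≡quotient = trans (nCk≡n!/k![n-k]! (m≤m+n k l))
      (cong (λ z → ((k + l) ! / (k ! * z !)) {{k !* z !≢0}}) k+l∸k≡l)
    k!l!∣[k+l]! : k ! * l ! ∣ (k + l) !
    k!l!∣[k+l]! = subst (λ z → k ! * z ! ∣ (k + l) !) k+l∸k≡l (k![n∸k]!∣n! (m≤m+n k l))

  -- Both sides count the ways of splitting k+r+s objects into blocks of sizes k, r, s.
  subset-of-subset : ∀ k r s →
    ((k + r + s) C k) * ((r + s) C r) ≡ ((k + r + s) C (k + r)) * ((k + r) C k)
  subset-of-subset k r s = *-cancelʳ-≡ _ _ (k ! * r ! * s !) {{k!r!s!≢0}} (trans lhs (sym rhs))
    where
    k!r!s!≢0 : NonZero (k ! * r ! * s !)
    k!r!s!≢0 = m*n≢0 (k ! * r !) (s !) {{m*n≢0 (k !) (r !) {{k !≢0}} {{r !≢0}}}} {{s !≢0}}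
    regroupˡ : ∀ a b c d e → a * b * (c * d * e) ≡ a * (c * (b * (d * e)))
    regroupˡ = solve-∀
    regroupʳ : ∀ a b c d e → a * b * (c * d * e) ≡ a * (b * (c * d)) * e
    regroupʳ = solve-∀
    lhs : ((k + r + s) C k) * ((r + s) C r) * (k ! * r ! * s !) ≡ (k + r + s) !
    lhs = begin
      ((k + r + s) C k) * ((r + s) C r) * (k ! * r ! * s !)
        ≡⟨ regroupˡ ((k + r + s) C k) ((r + s) C r) (k !) (r !) (s !) ⟩
      ((k + r + s) C k) * (k ! * (((r + s) C r) * (r ! * s !)))
        ≡⟨ cong (λ z → ((k + r + s) C k) * (k ! * z)) (choose-factorial r s) ⟩
      ((k + r + s) C k) * (k ! * (r + s) !)
        ≡⟨ cong (λ z → (z C k) * (k ! * (r + s) !)) (+-assoc k r s) ⟩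
      ((k + (r + s)) C k) * (k ! * (r + s) !)
        ≡⟨ choose-factorial k (r + s) ⟩
      (k + (r + s)) !
        ≡⟨ cong _! (+-assoc k r s) ⟨
      (k + r + s) ! ∎
    rhs : ((k + r + s) C (k + r)) * ((k + r) C k) * (k ! * r ! * s !) ≡ (k + r + s) !
    rhs = begin
      ((k + r + s) C (k + r)) * ((k + r) C k) * (k ! * r ! * s !)
        ≡⟨ regroupʳ ((k + r + s) C (k + r)) ((k + r) C k) (k !) (r !) (s !) ⟩
      ((k + r + s) C (k + r)) * (((k + r) C k) * (k ! * r !)) * s !
        ≡⟨ cong (λ z → ((k + r + s) C (k + r)) * z * s !) (choose-factorial k r) ⟩
      ((k + r + s) C (k + r)) * (k + r) ! * s !
        ≡⟨ *-assoc ((k + r + s) C (k + r)) _ _ ⟩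
      ((k + r + s) C (k + r)) * ((k + r) ! * s !)
        ≡⟨ choose-factorial (k + r) s ⟩
      (k + r + s) ! ∎

  -- C(n,k)·C(n-k,r) = C(n,k+r)·C(k+r,k), for all n, k, r (both sides vanish when k+r > n).
  choose-choose : ∀ n k r → (n C k) * ((n ∸ k) C r) ≡ (n C (k + r)) * ((k + r) C k)
  choose-choose n k r with split (k + r) n
  ... | above s = begin
    ((k + r + s) C k) * ((k + r + s ∸ k) C r) ≡⟨ cong (λ z → ((k + r + s) C k) * (z C r)) rest ⟩
    ((k + r + s) C k) * ((r + s) C r)         ≡⟨ subset-of-subset k r s ⟩
    ((k + r + s) C (k + r)) * ((k + r) C k)   ∎
    where
    rest : k + r + s ∸ k ≡ r + s
    rest = trans (cong (_∸ k) (+-assoc k r s)) (m+n∸m≡n k (r + s))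
  ... | below n<k+r = trans lhs-zero (cong (_* ((k + r) C k)) (sym (k>n⇒nCk≡0 n<k+r)))
    where
    lhs-zero : (n C k) * ((n ∸ k) C r) ≡ 0
    lhs-zero with split k n
    ... | below n<k = cong (_* ((n ∸ k) C r)) (k>n⇒nCk≡0 n<k)
    ... | above t   = begin
      ((k + t) C k) * ((k + t ∸ k) C r) ≡⟨ cong (λ z → ((k + t) C k) * (z C r)) (m+n∸m≡n k t) ⟩
      ((k + t) C k) * (t C r)           ≡⟨ cong (((k + t) C k) *_) (k>n⇒nCk≡0 (+-cancelˡ-< k t r n<k+r)) ⟩
      ((k + t) C k) * 0                 ≡⟨ *-zeroʳ ((k + t) C k) ⟩
      0                                 ∎

  -- Trinomial revision C(n,k)·C(n-k,i-k) = C(n,i)·C(i,k), where C(n-k,i-k) is written as the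
  -- coefficient of x^i in x^k(1+x)^(n-k) so that the case i < k needs no truncated subtraction.
  trinomial-revision : ∀ n k i → (n C k) * shift k ((n ∸ k) C_) i ≡ (n C i) * (i C k)
  trinomial-revision n k i with split k i
  ... | above r = trans (cong ((n C k) *_) (shift-above k ((n ∸ k) C_) r)) (choose-choose n k r)
  ... | below i<k = begin
    (n C k) * shift k ((n ∸ k) C_) i ≡⟨ cong ((n C k) *_) (shift-below k ((n ∸ k) C_) i i<k) ⟩
    (n C k) * 0                      ≡⟨ *-zeroʳ (n C k) ⟩
    0                                ≡⟨ *-zeroʳ (n C i) ⟨
    (n C i) * 0                      ≡⟨ cong ((n C i) *_) (k>n⇒nCk≡0 i<k) ⟨
    (n C i) * (i C k)                ∎

  -- Absorption (j+1)·C(m+1,j+1) = (m+1)·C(m,j): the case k = 1 of choose-choose.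
  absorption : ∀ m j → suc j * (suc m C suc j) ≡ suc m * (m C j)
  absorption m j = begin
    suc j * (suc m C suc j)             ≡⟨ *-comm (suc j) _ ⟩
    (suc m C suc j) * suc j             ≡⟨ cong ((suc m C suc j) *_) (nC1≡n (suc j)) ⟨
    (suc m C suc j) * (suc j C 1)       ≡⟨ choose-choose (suc m) 1 j ⟨
    (suc m C 1) * (m C j)               ≡⟨ cong (_* (m C j)) (nC1≡n (suc m)) ⟩
    suc m * (m C j)                     ∎

  -- Symmetry of binomial coefficients, in the form free of truncated subtraction.
  choose-complement : ∀ a b → (a + b) C a ≡ (a + b) C b
  choose-complement a b =
    trans (nCk≡nC[n∸k] (m≤m+n a b)) (cong ((a + b) C_) (m+n∸m≡n a b))

  -- Vandermonde's convolution Σ_t C(a,c+t)·C(b,t) = C(a+b,b+c), summed over any range t < L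
  -- that covers the support 0 ≤ t ≤ b of C(b,t).
  vandermonde : ∀ a b c L → b < L → Σℕ[ t < L ] ((a C (c + t)) * (b C t)) ≡ (a + b) C (b + c)
  vandermonde a zero c (suc L) _ = begin
    Σℕ[ t < suc L ] ((a C (c + t)) * (0 C t))
      ≡⟨ sum-front L _ ⟩
    (a C (c + 0)) * 1 + Σℕ[ t < L ] ((a C (c + suc t)) * 0)
      ≡⟨ cong₂ _+_ (*-identityʳ _) (sum-zero L _ (λ t → *-zeroʳ (a C (c + suc t)))) ⟩
    (a C (c + 0)) + 0 ≡⟨ +-identityʳ _ ⟩
    a C (c + 0)       ≡⟨ cong₂ _C_ (sym (+-identityʳ a)) (+-identityʳ c) ⟩
    (a + 0) C c       ∎
  vandermonde a (suc b) c (suc L) (s<s b<L) = begin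
    Σℕ[ t < suc L ] ((a C (c + t)) * (suc b C t))
      ≡⟨ sum-front L _ ⟩
    (a C (c + 0)) * 1 + Σℕ[ t < L ] ((a C (c + suc t)) * (suc b C suc t))
      ≡⟨ cong ((a C (c + 0)) * 1 +_) pascal ⟩
    (a C (c + 0)) * 1 + (Σℕ[ t < L ] ((a C (c + suc t)) * (b C t))
                         + Σℕ[ t < L ] ((a C (c + suc t)) * (b C suc t)))
      ≡⟨ rearrange ((a C (c + 0)) * 1) _ _ ⟩
    ((a C (c + 0)) * 1 + Σℕ[ t < L ] ((a C (c + suc t)) * (b C suc t)))
      + Σℕ[ t < L ] ((a C (c + suc t)) * (b C t))
      ≡⟨ cong₂ _+_ (trans (sym (sum-front L _)) (vandermonde a b c (suc L) (m<n⇒m<1+n b<L))) shifted ⟩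
    (a + b) C (b + c) + (a + b) C (b + suc c)
      ≡⟨ cong (λ z → (a + b) C (b + c) + (a + b) C z) (+-suc b c) ⟩
    (a + b) C (b + c) + (a + b) C suc (b + c)
      ≡⟨ nCk+nC[k+1]≡[n+1]C[k+1] (a + b) (b + c) ⟩
    suc (a + b) C suc (b + c)
      ≡⟨ cong (_C suc (b + c)) (+-suc a b) ⟨
    (a + suc b) C (suc b + c) ∎
    where
    rearrange : ∀ x y z → x + (y + z) ≡ (x + z) + y
    rearrange = solve-∀
    pascal : Σℕ[ t < L ] ((a C (c + suc t)) * (suc b C suc t))
           ≡ Σℕ[ t < L ] ((a C (c + suc t)) * (b C t)) + Σℕ[ t < L ] ((a C (c + suc t)) * (b C suc t))
    pascal = trans (sum-cong L (λ t → trans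
               (cong ((a C (c + suc t)) *_) (sym (nCk+nC[k+1]≡[n+1]C[k+1] b t)))
               (*-distribˡ-+ (a C (c + suc t)) (b C t) (b C suc t))))
             (sum-+ L _ _)
    shifted : Σℕ[ t < L ] ((a C (c + suc t)) * (b C t)) ≡ (a + b) C (b + suc c)
    shifted = trans (sum-cong L (λ t → cong (λ z → (a C z) * (b C t)) (+-suc c t)))
                    (vandermonde a b (suc c) L b<L)

  -- The coefficient of x^j in s_{m+1} is sNumerator m j / (m+1), and in w_{m+1} it is
  -- wNumerator m j / (j+1); see coeff-s and coeff-wp below.
  sNumerator : ℕ → ℕ → ℕ
  sNumerator m j = Σℕ[ t < suc m ] (((suc m C suc t) * (suc m C t)) * shift t ((suc m ∸ suc t) C_) j)

  wNumerator : ℕ → ℕ → ℕ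
  wNumerator m j = (m C j) * ((suc m + suc j) C j)

  -- The combinatorial heart of the theorem: with n = m+1 and i = j+1, trinomial revision turns
  -- Σ_k C(n,k)C(n,k-1)C(n-k,i-k) into C(n,i)·Σ_k C(i,k)C(n,k-1), Vandermonde sums this to
  -- C(n,i)·C(n+i,j), and absorption i·C(n,i) = n·C(m,j) finishes.
  numerator-identity : ∀ m j → suc j * sNumerator m j ≡ suc m * wNumerator m j
  numerator-identity m j = begin
    i * sNumerator m j
      ≡⟨ cong (i *_) extend ⟩
    i * sumℕ (suc n) term
      ≡⟨ cong (i *_) (sum-cong (suc n) revise) ⟩
    i * Σℕ[ t < suc n ] ((n C i) * ((i C suc t) * (n C t)))
      ≡⟨ cong (i *_) (sum-scale (suc n) (n C i) _) ⟩
    i * ((n C i) * Σℕ[ t < suc n ] ((i C (1 + t)) * (n C t)))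
      ≡⟨ cong (λ z → i * ((n C i) * z)) (vandermonde i n 1 (suc n) ≤-refl) ⟩
    i * ((n C i) * ((i + n) C (n + 1)))
      ≡⟨ cong (λ z → i * ((n C i) * z)) symmetry ⟩
    i * ((n C i) * ((n + i) C j))
      ≡⟨ *-assoc i (n C i) _ ⟨
    i * (n C i) * ((n + i) C j)
      ≡⟨ cong (_* ((n + i) C j)) (absorption m j) ⟩
    n * (m C j) * ((n + i) C j)
      ≡⟨ *-assoc n (m C j) _ ⟩
    n * wNumerator m j ∎
    where
    n i : ℕ
    n = suc m
    i = suc j
    term : ℕ → ℕ
    term t = ((n C suc t) * (n C t)) * shift t ((n ∸ suc t) C_) j
    -- Adding the term t = n changes nothing, as it contains the factor C(n,n+1) = 0.
    extend : sNumerator m j ≡ sumℕ (suc n) term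
    extend = sym (trans (cong (sumℕ n term +_) (cong (λ z → z * (n C n) * shift n ((n ∸ suc n) C_) j)
                   (k>n⇒nCk≡0 (n<1+n n)))) (+-identityʳ _))
    revise : ∀ t → term t ≡ (n C i) * ((i C suc t) * (n C t))
    revise t = begin
      ((n C suc t) * (n C t)) * shift (suc t) ((n ∸ suc t) C_) i
        ≡⟨ regroupˡ (n C suc t) (n C t) _ ⟩
      (n C t) * ((n C suc t) * shift (suc t) ((n ∸ suc t) C_) i)
        ≡⟨ cong ((n C t) *_) (trinomial-revision n (suc t) i) ⟩
      (n C t) * ((n C i) * (i C suc t))
        ≡⟨ regroupʳ (n C t) (n C i) (i C suc t) ⟩
      (n C i) * ((i C suc t) * (n C t)) ∎
      where
      regroupˡ : ∀ a b c → (a * b) * c ≡ b * (a * c)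
      regroupˡ = solve-∀
      regroupʳ : ∀ a b c → a * (b * c) ≡ b * (c * a)
      regroupʳ = solve-∀
    symmetry : (i + n) C (n + 1) ≡ (n + i) C j
    symmetry = begin
      (i + n) C (n + 1)     ≡⟨ cong (_C (n + 1)) (reorderˡ j m) ⟩
      (n + 1 + j) C (n + 1) ≡⟨ choose-complement (n + 1) j ⟩
      (n + 1 + j) C j       ≡⟨ cong (_C j) (reorderʳ j m) ⟩
      (n + i) C j           ∎
      where
      reorderˡ : ∀ a b → suc a + suc b ≡ suc b + 1 + a
      reorderˡ = solve-∀
      reorderʳ : ∀ a b → suc b + 1 + a ≡ suc b + suc a
      reorderʳ = solve-∀

module Fractions where

  open import Data.Nat as ℕ using (ℕ; suc)
  open import Data.Integer as ℤ using (+_)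
  import Data.Integer.Properties as ℤ
  open import Data.Integer.Tactic.RingSolver using (solve-∀)
  open import Data.Rational as ℚ using (ℚ; 0ℚ; toℚᵘ)
  import Data.Rational.Properties as ℚ
  open import Data.Rational.Unnormalised as ℚᵘ using (mkℚᵘ; *≡*)
  import Data.Rational.Unnormalised.Properties as ℚᵘ
  open import Relation.Binary.PropositionalEquality

  -- frac a m = a / (m+1); all coefficients of s_n and w_n have this shape.
  frac : ℕ → ℕ → ℚ
  frac a m = + a ℚ./ suc m

  ι : ℕ → ℚ
  ι a = frac a 0

  -- Arithmetic on fractions is checked on unnormalised representatives.
  frac-unnormalised : ∀ a m → toℚᵘ (frac a m) ℚᵘ.≃ mkℚᵘ (+ a) m
  frac-unnormalised a m = ℚ.toℚᵘ-fromℚᵘ (mkℚᵘ (+ a) m)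

  frac-zero : ∀ m → frac 0 m ≡ 0ℚ
  frac-zero m = ℚ.0/n≡0 (suc m)

  frac-+ : ∀ a b m → frac a m ℚ.+ frac b m ≡ frac (a ℕ.+ b) m
  frac-+ a b m = ℚ.toℚᵘ-injective
    (ℚᵘ.≃-trans (ℚ.toℚᵘ-homo-+ (frac a m) (frac b m))
    (ℚᵘ.≃-trans (ℚᵘ.+-cong (frac-unnormalised a m) (frac-unnormalised b m))
    (ℚᵘ.≃-trans (*≡* cross) (ℚᵘ.≃-sym (frac-unnormalised (a ℕ.+ b) m)))))
    where
    distrib : ∀ x y d → (x ℤ.* d ℤ.+ y ℤ.* d) ℤ.* d ≡ (x ℤ.+ y) ℤ.* (d ℤ.* d)
    distrib = solve-∀
    cross : (+ a ℤ.* + suc m ℤ.+ + b ℤ.* + suc m) ℤ.* + suc m ≡ + (a ℕ.+ b) ℤ.* + (suc m ℕ.* suc m)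
    cross = trans (distrib (+ a) (+ b) (+ suc m))
                  (sym (cong₂ ℤ._*_ (ℤ.pos-+ a b) (ℤ.pos-* (suc m) (suc m))))

  frac-*ι : ∀ a d m → frac a m ℚ.* ι d ≡ frac (a ℕ.* d) m
  frac-*ι a d m = ℚ.toℚᵘ-injective
    (ℚᵘ.≃-trans (ℚ.toℚᵘ-homo-* (frac a m) (ι d))
    (ℚᵘ.≃-trans (ℚᵘ.*-cong (frac-unnormalised a m) (frac-unnormalised d 0))
    (ℚᵘ.≃-trans (*≡* cross) (ℚᵘ.≃-sym (frac-unnormalised (a ℕ.* d) m)))))
    where
    unit : ∀ x y e → (x ℤ.* y) ℤ.* e ≡ (x ℤ.* y) ℤ.* (e ℤ.* + 1)
    unit = solve-∀
    cross : (+ a ℤ.* + d) ℤ.* + suc m ≡ + (a ℕ.* d) ℤ.* + (suc m ℕ.* 1)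
    cross = trans (unit (+ a) (+ d) (+ suc m))
                  (sym (cong₂ ℤ._*_ (ℤ.pos-* a d) (ℤ.pos-* (suc m) 1)))

  frac-cross : ∀ a b c d → a ℕ.* suc d ≡ c ℕ.* suc b → frac a b ≡ frac c d
  frac-cross a b c d ad≡cb = ℚ.fromℚᵘ-cong {mkℚᵘ (+ a) b} {mkℚᵘ (+ c) d}
    (*≡* (trans (sym (ℤ.pos-* a (suc d))) (trans (cong +_ ad≡cb) (ℤ.pos-* c (suc b)))))

module Coefficients where

  open BinomialIdentities using (sumℕ; shift)
  open Fractions using (ι; frac; frac-zero; frac-+)

  open import Data.Nat as ℕ using (ℕ; zero; suc; _≤_; z≤n; s≤s)
  open import Data.Nat.Combinatorics using (_C_; nCk+nC[k+1]≡[n+1]C[k+1])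
  import Data.Nat.Properties as ℕ
  open import Data.List using ([]; _∷_)
  open import Data.Rational as ℚ using (ℚ; 0ℚ; 1ℚ; _+_; _*_)
  import Data.Rational.Properties as ℚ
  open import Function using (_∘_)
  open import Relation.Binary.PropositionalEquality
  open ≡-Reasoning

  coeff-⊕ : ∀ p q j → coeff (p ⊕ q) j ≡ coeff p j + coeff q j
  coeff-⊕ []      q       j       = sym (ℚ.+-identityˡ _)
  coeff-⊕ (a ∷ p) []      j       = sym (ℚ.+-identityʳ _)
  coeff-⊕ (a ∷ p) (b ∷ q) zero    = refl
  coeff-⊕ (a ∷ p) (b ∷ q) (suc j) = coeff-⊕ p q j

  coeff-scale : ∀ c p j → coeff (scale c p) j ≡ c * coeff p j
  coeff-scale c []      j       = sym (ℚ.*-zeroʳ c)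
  coeff-scale c (a ∷ p) zero    = refl
  coeff-scale c (a ∷ p) (suc j) = coeff-scale c p j

  -- Cauchy product of coefficient sequences: (f ⋆ g)_j = Σ_{i ≤ j} f_i g_{j-i}.
  convolution : (ℕ → ℚ) → (ℕ → ℚ) → ℕ → ℚ
  convolution f g zero    = f 0 * g 0
  convolution f g (suc j) = f 0 * g (suc j) + convolution (f ∘ suc) g j

  convolution-cong : ∀ {f f′} g j → (∀ i → f i ≡ f′ i) → convolution f g j ≡ convolution f′ g j
  convolution-cong g zero    f≗f′ = cong (_* g 0) (f≗f′ 0)
  convolution-cong g (suc j) f≗f′ =
    cong₂ _+_ (cong (_* g (suc j)) (f≗f′ 0)) (convolution-cong g j (f≗f′ ∘ suc))

  convolution-zeroˡ : ∀ g j → convolution (λ _ → 0ℚ) g j ≡ 0ℚ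
  convolution-zeroˡ g zero    = ℚ.*-zeroˡ (g 0)
  convolution-zeroˡ g (suc j) =
    trans (cong₂ _+_ (ℚ.*-zeroˡ (g (suc j))) (convolution-zeroˡ g j)) (ℚ.+-identityˡ 0ℚ)

  convolution-oneˡ : ∀ g j → convolution (coeff (const 1ℚ)) g j ≡ g j
  convolution-oneˡ g zero    = ℚ.*-identityˡ (g 0)
  convolution-oneˡ g (suc j) =
    trans (cong₂ _+_ (ℚ.*-identityˡ (g (suc j))) (convolution-zeroˡ g j)) (ℚ.+-identityʳ (g (suc j)))

  convolution-raiseˡ : ∀ p g j → convolution (coeff (0ℚ ∷ p)) g (suc j) ≡ convolution (coeff p) g j
  convolution-raiseˡ p g j =
    trans (cong (_+ convolution (coeff p) g j) (ℚ.*-zeroˡ (g (suc j)))) (ℚ.+-identityˡ _)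

  coeff-⊗ : ∀ p q j → coeff (p ⊗ q) j ≡ convolution (coeff p) (coeff q) j
  coeff-⊗ []      q j       = sym (convolution-zeroˡ (coeff q) j)
  coeff-⊗ (a ∷ p) q zero    = begin
    coeff (scale a q ⊕ (0ℚ ∷ (p ⊗ q))) 0 ≡⟨ coeff-⊕ (scale a q) (0ℚ ∷ (p ⊗ q)) 0 ⟩
    coeff (scale a q) 0 + 0ℚ              ≡⟨ ℚ.+-identityʳ _ ⟩
    coeff (scale a q) 0                   ≡⟨ coeff-scale a q 0 ⟩
    a * coeff q 0                         ∎
  coeff-⊗ (a ∷ p) q (suc j) =
    trans (coeff-⊕ (scale a q) (0ℚ ∷ (p ⊗ q)) (suc j))
          (cong₂ _+_ (coeff-scale a q (suc j)) (coeff-⊗ p q j))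

  coeff-X⊗ : ∀ p j → coeff (X ⊗ p) j ≡ coeff (0ℚ ∷ p) j
  coeff-X⊗ p zero    = trans (coeff-⊗ X p 0) (ℚ.*-zeroˡ (coeff p 0))
  coeff-X⊗ p (suc j) = begin
    coeff (X ⊗ p) (suc j)                         ≡⟨ coeff-⊗ X p (suc j) ⟩
    convolution (coeff X) (coeff p) (suc j)       ≡⟨ convolution-raiseˡ (const 1ℚ) (coeff p) j ⟩
    convolution (coeff (const 1ℚ)) (coeff p) j    ≡⟨ convolution-oneˡ (coeff p) j ⟩
    coeff p j                                     ∎

  coeff-X^⊗ : ∀ a (f : ℕ → ℕ) q → (∀ i → coeff q i ≡ ι (f i)) →
              ∀ j → coeff ((X ^ₚ a) ⊗ q) j ≡ ι (shift a f j)
  coeff-X^⊗ a f q q≡f j = trans (coeff-⊗ (X ^ₚ a) q j) (shifted a j)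
    where
    shifted : ∀ a j → convolution (coeff (X ^ₚ a)) (coeff q) j ≡ ι (shift a f j)
    shifted zero    j       = trans (convolution-oneˡ (coeff q) j) (q≡f j)
    shifted (suc a) zero    =
      trans (convolution-cong (coeff q) 0 (coeff-X⊗ (X ^ₚ a))) (ℚ.*-zeroˡ (coeff q 0))
    shifted (suc a) (suc j) = begin
      convolution (coeff (X ⊗ (X ^ₚ a))) (coeff q) (suc j)
        ≡⟨ convolution-cong (coeff q) (suc j) (coeff-X⊗ (X ^ₚ a)) ⟩
      convolution (coeff (0ℚ ∷ (X ^ₚ a))) (coeff q) (suc j)
        ≡⟨ convolution-raiseˡ (X ^ₚ a) (coeff q) j ⟩
      convolution (coeff (X ^ₚ a)) (coeff q) j
        ≡⟨ shifted a j ⟩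
      ι (shift a f j) ∎

  coeff-binomial : ∀ b j → coeff ((X ⊕ const 1ℚ) ^ₚ b) j ≡ ι (b C j)
  coeff-binomial zero    zero    = refl
  coeff-binomial zero    (suc j) = refl
  coeff-binomial (suc b) zero    = begin
    coeff ((X ⊕ const 1ℚ) ⊗ Y) 0 ≡⟨ coeff-⊗ (X ⊕ const 1ℚ) Y 0 ⟩
    (0ℚ + 1ℚ) * coeff Y 0        ≡⟨ cong₂ _*_ (ℚ.+-identityˡ 1ℚ) (coeff-binomial b 0) ⟩
    1ℚ * ι 1                     ≡⟨ ℚ.*-identityˡ (ι 1) ⟩
    ι 1                          ∎
    where
    Y : Poly
    Y = (X ⊕ const 1ℚ) ^ₚ b
  coeff-binomial (suc b) (suc j) = begin
    coeff ((X ⊕ const 1ℚ) ⊗ Y) (suc j)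
      ≡⟨ coeff-⊗ (X ⊕ const 1ℚ) Y (suc j) ⟩
    (0ℚ + 1ℚ) * coeff Y (suc j) + convolution (coeff (const 1ℚ)) (coeff Y) j
      ≡⟨ cong₂ _+_ (trans (cong (_* coeff Y (suc j)) (ℚ.+-identityˡ 1ℚ)) (ℚ.*-identityˡ (coeff Y (suc j))))
                   (convolution-oneˡ (coeff Y) j) ⟩
    coeff Y (suc j) + coeff Y j
      ≡⟨ cong₂ _+_ (coeff-binomial b (suc j)) (coeff-binomial b j) ⟩
    ι (b C suc j) + ι (b C j)
      ≡⟨ frac-+ (b C suc j) (b C j) 0 ⟩
    ι ((b C suc j) ℕ.+ (b C j))
      ≡⟨ cong ι (trans (ℕ.+-comm (b C suc j) (b C j)) (nCk+nC[k+1]≡[n+1]C[k+1] b j)) ⟩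
    ι (suc b C suc j) ∎
    where
    Y : Poly
    Y = (X ⊕ const 1ℚ) ^ₚ b

  sumℚ : ℕ → (ℕ → ℚ) → ℚ
  sumℚ zero    f = 0ℚ
  sumℚ (suc n) f = sumℚ n f + f n

  syntax sumℚ n (λ t → e) = Σℚ[ t < n ] e

  sumℚ-cong : ∀ n {f g : ℕ → ℚ} → (∀ t → f t ≡ g t) → sumℚ n f ≡ sumℚ n g
  sumℚ-cong zero    f≗g = refl
  sumℚ-cong (suc n) f≗g = cong₂ _+_ (sumℚ-cong n f≗g) (f≗g n)

  sumℚ-zero : ∀ n (f : ℕ → ℚ) → (∀ t → f t ≡ 0ℚ) → sumℚ n f ≡ 0ℚ
  sumℚ-zero zero    f f≗0 = refl
  sumℚ-zero (suc n) f f≗0 = trans (cong₂ _+_ (sumℚ-zero n f f≗0) (f≗0 n)) (ℚ.+-identityˡ 0ℚ)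

  sumℚ-front : ∀ n (f : ℕ → ℚ) → sumℚ (suc n) f ≡ f 0 + Σℚ[ t < n ] f (suc t)
  sumℚ-front zero    f = trans (ℚ.+-identityˡ (f 0)) (sym (ℚ.+-identityʳ (f 0)))
  sumℚ-front (suc n) f =
    trans (cong (_+ f (suc n)) (sumℚ-front n f)) (ℚ.+-assoc (f 0) _ (f (suc n)))

  sumℚ-frac : ∀ n (h : ℕ → ℕ) m → Σℚ[ t < n ] frac (h t) m ≡ frac (sumℕ n h) m
  sumℚ-frac zero    h m = sym (frac-zero m)
  sumℚ-frac (suc n) h m =
    trans (cong (_+ frac (h n) m) (sumℚ-frac n h m)) (frac-+ (sumℕ n h) (h n) m)

  coeff-sumFrom1 : ∀ n f j → coeff (sumFrom1 n f) j ≡ Σℚ[ t < n ] coeff (f (suc t)) j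
  coeff-sumFrom1 zero    f j = refl
  coeff-sumFrom1 (suc n) f j =
    trans (coeff-⊕ (sumFrom1 n f) (f (suc n)) j) (cong (_+ coeff (f (suc n)) j) (coeff-sumFrom1 n f j))

  coeff-monomials : ∀ n (c : ℕ → ℚ) j → (∀ t → n ≤ t → c t ≡ 0ℚ) →
                    Σℚ[ t < n ] (c t * coeff (X ^ₚ t) j) ≡ c j
  coeff-monomials zero    c j       vanish = sym (vanish j z≤n)
  coeff-monomials (suc n) c zero    vanish = begin
    Σℚ[ t < suc n ] (c t * coeff (X ^ₚ t) 0)
      ≡⟨ sumℚ-front n _ ⟩
    c 0 * 1ℚ + Σℚ[ t < n ] (c (suc t) * coeff (X ^ₚ suc t) 0)
      ≡⟨ cong₂ _+_ (ℚ.*-identityʳ (c 0)) (sumℚ-zero n _ (λ t →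
           trans (cong (c (suc t) *_) (coeff-X⊗ (X ^ₚ t) 0)) (ℚ.*-zeroʳ (c (suc t))))) ⟩
    c 0 + 0ℚ
      ≡⟨ ℚ.+-identityʳ (c 0) ⟩
    c 0 ∎
  coeff-monomials (suc n) c (suc j) vanish = begin
    Σℚ[ t < suc n ] (c t * coeff (X ^ₚ t) (suc j))
      ≡⟨ sumℚ-front n _ ⟩
    c 0 * 0ℚ + Σℚ[ t < n ] (c (suc t) * coeff (X ^ₚ suc t) (suc j))
      ≡⟨ cong₂ _+_ (ℚ.*-zeroʳ (c 0)) (sumℚ-cong n (λ t → cong (c (suc t) *_) (coeff-X⊗ (X ^ₚ t) (suc j)))) ⟩
    0ℚ + Σℚ[ t < n ] (c (suc t) * coeff (X ^ₚ t) j)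
      ≡⟨ ℚ.+-identityˡ _ ⟩
    Σℚ[ t < n ] (c (suc t) * coeff (X ^ₚ t) j)
      ≡⟨ coeff-monomials n (c ∘ suc) j (λ t n≤t → vanish (suc t) (s≤s n≤t)) ⟩
    c (suc j) ∎

open BinomialIdentities using (shift; sNumerator; wNumerator; numerator-identity)
open Fractions using (ι; frac; frac-zero; frac-*ι; frac-cross)
open Coefficients

open import Data.Nat using (_+_; _*_; _∸_; _≤_)
open import Data.Nat.Properties using (*-comm)
open import Data.Nat.Combinatorics using (_C_; k>n⇒nCk≡0)
import Data.Rational as ℚ
open ℚ using (0ℚ; 1ℚ)
open import Relation.Binary.PropositionalEquality using (sym; trans; cong; module ≡-Reasoning)
open ≡-Reasoning

coeff-wp : ∀ m j → coeff (wp (suc m)) j ≡ frac (wNumerator m j) j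
coeff-wp m j = begin
  coeff (wp (suc m)) j
    ≡⟨ coeff-sumFrom1 (suc m) _ j ⟩
  Σℚ[ t < suc m ] coeff (scale (w (suc m) (suc t)) (X ^ₚ t)) j
    ≡⟨ sumℚ-cong (suc m) (λ t → coeff-scale (w (suc m) (suc t)) (X ^ₚ t) j) ⟩
  Σℚ[ t < suc m ] (w (suc m) (suc t) ℚ.* coeff (X ^ₚ t) j)
    ≡⟨ coeff-monomials (suc m) (λ t → w (suc m) (suc t)) j vanish ⟩
  frac (wNumerator m j) j ∎
  where
  vanish : ∀ t → suc m ≤ t → w (suc m) (suc t) ≡ 0ℚ
  vanish t m<t =
    trans (cong (λ z → frac (z * ((suc m + suc t) C t)) t) (k>n⇒nCk≡0 m<t)) (frac-zero t)

-- Coefficient j of s_{m+1} is sNumerator m j / (m+1): the coefficient of x^j in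
-- x^(k-1)(x+1)^(n-k) is the shifted binomial coefficient, and N(n,k) has denominator n.
coeff-s : ∀ m j → coeff (s (suc m)) j ≡ frac (sNumerator m j) m
coeff-s m j = begin
  coeff (s n) j
    ≡⟨ coeff-sumFrom1 n _ j ⟩
  Σℚ[ t < n ] coeff (scale (N n (suc t)) ((X ^ₚ t) ⊗ Y (n ∸ suc t))) j
    ≡⟨ sumℚ-cong n term ⟩
  Σℚ[ t < n ] frac (((n C suc t) * (n C t)) * shift t ((n ∸ suc t) C_) j) m
    ≡⟨ sumℚ-frac n _ m ⟩
  frac (sNumerator m j) m ∎
  where
  n : ℕ
  n = suc m
  Y : ℕ → Poly
  Y b = (X ⊕ const 1ℚ) ^ₚ b
  term : ∀ t → coeff (scale (N n (suc t)) ((X ^ₚ t) ⊗ Y (n ∸ suc t))) j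
             ≡ frac (((n C suc t) * (n C t)) * shift t ((n ∸ suc t) C_) j) m
  term t = begin
    coeff (scale (N n (suc t)) ((X ^ₚ t) ⊗ Y (n ∸ suc t))) j
      ≡⟨ coeff-scale (N n (suc t)) ((X ^ₚ t) ⊗ Y (n ∸ suc t)) j ⟩
    N n (suc t) ℚ.* coeff ((X ^ₚ t) ⊗ Y (n ∸ suc t)) j
      ≡⟨ cong (N n (suc t) ℚ.*_)
              (coeff-X^⊗ t ((n ∸ suc t) C_) (Y (n ∸ suc t)) (coeff-binomial (n ∸ suc t)) j) ⟩
    N n (suc t) ℚ.* ι (shift t ((n ∸ suc t) C_) j)
      ≡⟨ frac-*ι ((n C suc t) * (n C t)) _ m ⟩
    frac (((n C suc t) * (n C t)) * shift t ((n ∸ suc t) C_) j) m ∎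

lemma4p5 : (m j : ℕ) → coeff (wp (suc m)) j ≡ coeff (s (suc m)) j
lemma4p5 m j = begin
  coeff (wp (suc m)) j    ≡⟨ coeff-wp m j ⟩
  frac (wNumerator m j) j ≡⟨ frac-cross (wNumerator m j) j (sNumerator m j) m cross ⟩
  frac (sNumerator m j) m ≡⟨ coeff-s m j ⟨
  coeff (s (suc m)) j     ∎
  where
  cross : wNumerator m j * suc m ≡ sNumerator m j * suc j
  cross = trans (*-comm (wNumerator m j) (suc m))
         (trans (sym (numerator-identity m j)) (*-comm (suc j) (sNumerator m j)))
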